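{- Let $n \ge 1$ and let $U_f : \mathbb{Z}_3^{n-1} \to \{A,B,C,X,Y,Z\}$, with corresponding set $U = \bigcup_{x \in \mathbb{Z}_3^{n-1}} U_f(x) \times \{x\} \subseteq \mathbb{Z}_3^n$. If the subgraph of $H(n,3)$ induced by $U$ has maximum degree $1$, then there exists $V \subseteq \mathbb{Z}_3^{n+1}$ such that $|V| - 3^{n} = |U| - 3^{n-1}$ and the subgraph of $H(n+1,3)$ induced by $V$ has maximum degree $1$.
   Context: $H(m,3)$ is the Hamming graph on $\mathbb{Z}_3^m$ (vertices adjacent iff they differ in exactly one coordinate). $A = \{0\}$, $B = \{1\}$, $C = \{2\}$, $X = \{1,2\}$, $Y = \{0,2\}$, $Z = \{0,1\}$ are subsets of $\mathbb{Z}_3$; in $U_f(x) \times \{x\}$ the element of $U_f(x)$ is the first coordinate. -}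

module Defs where

open import Data.Bool using (Bool; true; false; _∧_; if_then_else_)
open import Data.Nat using (ℕ; zero; suc; _+_; _≤_; _≡ᵇ_)
open import Data.Fin using (Fin; zero; suc)
open import Data.Fin.Properties using (_≟_)
open import Data.Vec using (Vec; []; _∷_)
open import Data.List using (List; []; _∷_; map; concatMap)
open import Relation.Nullary.Decidable using (⌊_⌋)
open import Relation.Binary.PropositionalEquality using (_≡_)

Z3 : Set
Z3 = Fin 3

Pt : ℕ → Set
Pt m = Vec Z3 m

Subset3 : ℕ → Set
Subset3 m = Pt m → Bool

allPts : (m : ℕ) → List (Pt m)
allPts zero    = [] ∷ []
allPts (suc m) = concatMap (λ v → map (_∷ v) (zero ∷ suc zero ∷ suc (suc zero) ∷ [])) (allPts m)

countB : ∀ {A : Set} → (A → Bool) → List A → ℕ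
countB p []       = 0
countB p (a ∷ as) = (if p a then 1 else 0) + countB p as

card : ∀ {m} → Subset3 m → ℕ
card {m} S = countB S (allPts m)

hdist : ∀ {m} → Pt m → Pt m → ℕ
hdist []       []       = 0
hdist (a ∷ v) (b ∷ w) = (if ⌊ a ≟ b ⌋ then 0 else 1) + hdist v w

adj : ∀ {m} → Pt m → Pt m → Bool
adj v w = hdist v w ≡ᵇ 1

degIn : ∀ {m} → Subset3 m → Pt m → ℕ
degIn {m} S v = countB (λ w → S w ∧ adj v w) (allPts m)

MaxDeg≤1 : ∀ {m} → Subset3 m → Set
MaxDeg≤1 S = ∀ v → S v ≡ true → degIn S v ≤ 1

data Label : Set where
  A B C X Y Z : Label

-- The subset of Z_3 denoted by each label
-- A={0}, B={1}, C={2}, X={1,2}, Y={0,2}, Z={0,1}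
⟦_⟧ : Label → Z3 → Bool
⟦ A ⟧ zero          = true
⟦ A ⟧ _             = false
⟦ B ⟧ (suc zero)    = true
⟦ B ⟧ _             = false
⟦ C ⟧ (suc (suc zero)) = true
⟦ C ⟧ _             = false
⟦ X ⟧ zero          = false
⟦ X ⟧ _             = true
⟦ Y ⟧ (suc zero)    = false
⟦ Y ⟧ _             = true
⟦ Z ⟧ (suc (suc zero)) = false
⟦ Z ⟧ _             = true

-- U = ⋃_x U_f(x) × {x} ⊆ Z_3^(k+1); the U_f(x)-element is the first coordinate
UofF : ∀ {k} → (Pt k → Label) → Subset3 (suc k)
UofF Uf (u ∷ x) = ⟦ Uf x ⟧ u

{-# OPTIONS --safe #-}
-- Write a point of Z₃^(n+1) as (u, w, x) with x ∈ Z₃^(n-1) and put V = ⋃ₓ lift(U_f(x)) × {x},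
-- where lift(l) ⊆ Z₃² has |l| + 2 points; then |V| − 3ⁿ = |U| − 3ⁿ⁻¹.  The map
-- (u, w, x) ↦ (w − u, x) sends V into U.  Since H(j + k, 3) is the Cartesian product of
-- H(j, 3) and H(k, 3), the degree of (p, x) in a set S is the degree of p inside the fibre
-- of S over x plus the number of neighbours x' of x whose fibre contains p.  The map does
-- not increase the first term (a finite check on the six labels) nor the second one (it
-- sends each fibre of V into the corresponding fibre of U), so degrees in V are bounded by
-- degrees in U.
module Submission where

open import Defs
open import Data.Nat using (ℕ; zero; suc; _^_; _+_; _*_; _≤_; _≤?_; _≡ᵇ_; z≤n)
open import Data.Integer using (ℤ; +_; _-_)
open import Data.Product using (Σ; _×_; _,_)
open import Relation.Binary.PropositionalEquality using (_≡_; refl; sym; trans; cong; cong₂; module ≡-Reasoning)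

open import Data.Bool using (Bool; true; false; _∧_; not; if_then_else_)
open import Data.Bool.Properties using (∧-zeroʳ; ∧-identityʳ) renaming (_≟_ to _≟ᵇ_)
open import Data.Fin using (zero; suc; toℕ)
open import Data.Fin.Properties using (_≟_)
import Data.Integer as ℤ
open import Data.Integer.Properties using (pos-+; pos-*)
import Data.Integer.Tactic.RingSolver as ℤ-Solver
open import Data.List as List using (List; []; _∷_; map; concatMap)
open import Data.List.Membership.Propositional using (_∈_)
open import Data.List.Membership.Propositional.Properties using (∈-map⁺; ∈-concatMap⁺)
open import Data.List.Properties using (map-++; map-cong)
open import Data.List.Relation.Unary.All using (all?) renaming (lookup to lookupAll)
open import Data.List.Relation.Unary.Any as Any using (here; there)
open import Data.Nat.DivMod using (_mod_)
open import Data.Nat.ListAction using (sum)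
open import Data.Nat.ListAction.Properties using (sum-++)
open import Data.Nat.Properties using (+-identityʳ; *-identityʳ; +-assoc; +-mono-≤; ≤-refl; module ≤-Reasoning)
import Data.Nat.Tactic.RingSolver as ℕ-Solver
open import Data.Vec using ([]; _∷_; _++_; splitAt)
open import Relation.Nullary.Decidable using (Dec; True; toWitness; ⌊_⌋; _→-dec_)

ind : Bool → ℕ
ind b = if b then 1 else 0

private variable I J : Set

∑ : List I → (I → ℕ) → ℕ
∑ xs f = sum (map f xs)

syntax ∑ xs (λ x → e) = ∑[ x ∈ xs ] e

countB≡∑ : (P : I → Bool) (xs : List I) → countB P xs ≡ ∑[ a ∈ xs ] ind (P a)
countB≡∑ P []       = refl
countB≡∑ P (a ∷ as) = cong (_+_ (ind (P a))) (countB≡∑ P as)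

countB-mono : {P Q : I → Bool} → (∀ a → ind (P a) ≤ ind (Q a)) → ∀ xs → countB P xs ≤ countB Q xs
countB-mono P≤Q []       = z≤n
countB-mono P≤Q (a ∷ as) = +-mono-≤ (P≤Q a) (countB-mono P≤Q as)

∑-cong : {f g : I → ℕ} (xs : List I) → (∀ a → f a ≡ g a) → ∑ xs f ≡ ∑ xs g
∑-cong xs f≡g = cong sum (map-cong f≡g xs)

∑-+ : {f g : I → ℕ} (xs : List I) → ∑[ a ∈ xs ] (f a + g a) ≡ ∑ xs f + ∑ xs g
∑-+                 []       = refl
∑-+ {f = f} {g = g} (a ∷ as) = trans (cong (_+_ (f a + g a)) (∑-+ as)) (interchange (f a) (g a) _ _)
  where
  interchange : ∀ m n o p → (m + n) + (o + p) ≡ (m + o) + (n + p)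
  interchange = ℕ-Solver.solve-∀

∑-0 : (xs : List I) → ∑[ _ ∈ xs ] 0 ≡ 0
∑-0 []       = refl
∑-0 (_ ∷ xs) = ∑-0 xs

∑-++ : (xs ys : List I) (f : I → ℕ) → ∑ (xs List.++ ys) f ≡ ∑ xs f + ∑ ys f
∑-++ xs ys f = trans (cong sum (map-++ f xs ys)) (sum-++ (map f xs) (map f ys))

∑-comm : (xs : List I) (ys : List J) (f : I → J → ℕ) →
         ∑[ x ∈ xs ] ∑[ y ∈ ys ] f x y ≡ ∑[ y ∈ ys ] ∑[ x ∈ xs ] f x y
∑-comm []       ys f = sym (∑-0 ys)
∑-comm (x ∷ xs) ys f = trans (cong (_+_ (∑ ys (f x))) (∑-comm xs ys f)) (sym (∑-+ ys))

∑-concatMap : (g : I → List J) (xs : List I) (f : J → ℕ) →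
              ∑ (concatMap g xs) f ≡ ∑[ x ∈ xs ] ∑ (g x) f
∑-concatMap g []       f = refl
∑-concatMap g (x ∷ xs) f =
  trans (∑-++ (g x) (concatMap g xs) f) (cong (_+_ (∑ (g x) f)) (∑-concatMap g xs f))

Z3s : List Z3
Z3s = zero ∷ suc zero ∷ suc (suc zero) ∷ []

∈-Z3s : (a : Z3) → a ∈ Z3s
∈-Z3s zero             = here refl
∈-Z3s (suc zero)       = there (here refl)
∈-Z3s (suc (suc zero)) = there (there (here refl))

∈-allPts : ∀ {m} (v : Pt m) → v ∈ allPts m
∈-allPts []      = here refl
∈-allPts (a ∷ v) = ∈-concatMap⁺ _ (Any.map (λ { refl → ∈-map⁺ (_∷ v) (∈-Z3s a) }) (∈-allPts v))

∑-allPts-suc : ∀ m (f : Pt (suc m) → ℕ) → ∑ (allPts (suc m)) f ≡ ∑[ v ∈ allPts m ] ∑[ a ∈ Z3s ] f (a ∷ v)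
∑-allPts-suc m f = ∑-concatMap _ (allPts m) f

∑-allPts-++ : ∀ j {k} (f : Pt (j + k) → ℕ) → ∑ (allPts (j + k)) f ≡ ∑[ x ∈ allPts k ] ∑[ p ∈ allPts j ] f (p ++ x)
∑-allPts-++ zero    {k} f = sym (∑-cong (allPts k) (λ x → +-identityʳ (f x)))
∑-allPts-++ (suc j) {k} f = begin
  ∑ (allPts (suc j + k)) f                                     ≡⟨ ∑-allPts-suc (j + k) f ⟩
  ∑[ y ∈ allPts (j + k) ] ∑[ a ∈ Z3s ] f (a ∷ y)                ≡⟨ ∑-allPts-++ j _ ⟩
  ∑[ x ∈ allPts k ] ∑[ q ∈ allPts j ] ∑[ a ∈ Z3s ] f (a ∷ q ++ x) ≡⟨ ∑-cong (allPts k) (λ x → sym (∑-allPts-suc j (λ p → f (p ++ x)))) ⟩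
  ∑[ x ∈ allPts k ] ∑[ p ∈ allPts (suc j) ] f (p ++ x)          ∎
  where open ≡-Reasoning

∑-allPts-const : ∀ m c → ∑[ _ ∈ allPts m ] c ≡ c * 3 ^ m
∑-allPts-const zero    c = trans (+-identityʳ c) (sym (*-identityʳ c))
∑-allPts-const (suc m) c =
  trans (∑-allPts-suc m (λ _ → c)) (trans (∑-allPts-const m (c + (c + (c + 0)))) (triple c (3 ^ m)))
  where
  triple : ∀ c n → (c + (c + (c + 0))) * n ≡ c * (3 * n)
  triple = ℕ-Solver.solve-∀

hdist-++ : ∀ {j k} (p q : Pt j) (x y : Pt k) → hdist (p ++ x) (q ++ y) ≡ hdist p q + hdist x y
hdist-++ []      []      x y = refl
hdist-++ (a ∷ p) (b ∷ q) x y =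
  trans (cong (_+_ (if ⌊ a ≟ b ⌋ then 0 else 1)) (hdist-++ p q x y)) (sym (+-assoc _ (hdist p q) (hdist x y)))

∑-hdist≡0 : ∀ {m} (x : Pt m) (S : Subset3 m) → ∑[ y ∈ allPts m ] ind ((hdist x y ≡ᵇ 0) ∧ S y) ≡ ind (S x)
∑-hdist≡0 []      S = +-identityʳ (ind (S []))
∑-hdist≡0 {suc m} (a ∷ x) S = begin
  ∑[ y ∈ allPts (suc m) ] ind ((hdist (a ∷ x) y ≡ᵇ 0) ∧ S y)    ≡⟨ ∑-allPts-suc m _ ⟩
  ∑[ y ∈ allPts m ] ∑[ b ∈ Z3s ] ind ((hdist (a ∷ x) (b ∷ y) ≡ᵇ 0) ∧ S (b ∷ y))
    ≡⟨ ∑-cong (allPts m) (λ y → ∑-Z3s a (hdist x y) (λ b → S (b ∷ y))) ⟩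
  ∑[ y ∈ allPts m ] ind ((hdist x y ≡ᵇ 0) ∧ S (a ∷ y))            ≡⟨ ∑-hdist≡0 x (λ y → S (a ∷ y)) ⟩
  ind (S (a ∷ x))                                                 ∎
  where
  open ≡-Reasoning
  ∑-Z3s : ∀ a n (s : Z3 → Bool) →
          ∑[ b ∈ Z3s ] ind (((if ⌊ a ≟ b ⌋ then 0 else 1) + n ≡ᵇ 0) ∧ s b) ≡ ind ((n ≡ᵇ 0) ∧ s a)
  ∑-Z3s zero             n s = +-identityʳ _
  ∑-Z3s (suc zero)       n s = +-identityʳ _
  ∑-Z3s (suc (suc zero)) n s = +-identityʳ _

-- A neighbour of (p, x) in H(j + k, 3) either shares x with it or shares p.
ind-∧-+≡ᵇ1 : ∀ s m n → ind (s ∧ (m + n ≡ᵇ 1)) ≡ ind ((n ≡ᵇ 0) ∧ (s ∧ (m ≡ᵇ 1))) + ind ((m ≡ᵇ 0) ∧ (s ∧ (n ≡ᵇ 1)))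
ind-∧-+≡ᵇ1 false m n rewrite ∧-zeroʳ (n ≡ᵇ 0) | ∧-zeroʳ (m ≡ᵇ 0) = refl
ind-∧-+≡ᵇ1 true zero n rewrite ∧-zeroʳ (n ≡ᵇ 0) = refl
ind-∧-+≡ᵇ1 true (suc zero) n rewrite ∧-identityʳ (n ≡ᵇ 0) = sym (+-identityʳ _)
ind-∧-+≡ᵇ1 true (suc (suc m)) n rewrite ∧-zeroʳ (n ≡ᵇ 0) = refl

degIn-++ : ∀ j {k} (S : Subset3 (j + k)) (p : Pt j) (x : Pt k) →
           degIn S (p ++ x) ≡ degIn (λ q → S (q ++ x)) p + degIn (λ y → S (p ++ y)) x
degIn-++ j {k} S p x = begin
  degIn S (p ++ x)
    ≡⟨ countB≡∑ _ (allPts (j + k)) ⟩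
  ∑[ z ∈ allPts (j + k) ] ind (S z ∧ adj (p ++ x) z)
    ≡⟨ ∑-allPts-++ j _ ⟩
  ∑[ y ∈ allPts k ] ∑[ q ∈ allPts j ] ind (S (q ++ y) ∧ adj (p ++ x) (q ++ y))
    ≡⟨ ∑-cong (allPts k) (λ y → ∑-cong (allPts j) (λ q → split q y)) ⟩
  ∑[ y ∈ allPts k ] ∑[ q ∈ allPts j ] (inFibre q y + inColumn q y)
    ≡⟨ ∑-cong (allPts k) (λ y → ∑-+ (allPts j)) ⟩
  ∑[ y ∈ allPts k ] (∑[ q ∈ allPts j ] inFibre q y + ∑[ q ∈ allPts j ] inColumn q y)
    ≡⟨ ∑-+ (allPts k) ⟩
  ∑[ y ∈ allPts k ] ∑[ q ∈ allPts j ] inFibre q y + ∑[ y ∈ allPts k ] ∑[ q ∈ allPts j ] inColumn q y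
    ≡⟨ cong₂ _+_ (trans (∑-comm (allPts k) (allPts j) (λ y q → inFibre q y))
                        (∑-cong (allPts j) (λ q → ∑-hdist≡0 x _)))
                 (∑-cong (allPts k) (λ y → ∑-hdist≡0 p _)) ⟩
  ∑[ q ∈ allPts j ] ind (S (q ++ x) ∧ adj p q) + ∑[ y ∈ allPts k ] ind (S (p ++ y) ∧ adj x y)
    ≡⟨ sym (cong₂ _+_ (countB≡∑ _ (allPts j)) (countB≡∑ _ (allPts k))) ⟩
  degIn (λ q → S (q ++ x)) p + degIn (λ y → S (p ++ y)) x
    ∎
  where
  open ≡-Reasoning
  inFibre inColumn : Pt j → Pt k → ℕ
  inFibre  q y = ind ((hdist x y ≡ᵇ 0) ∧ (S (q ++ y) ∧ adj p q))
  inColumn q y = ind ((hdist p q ≡ᵇ 0) ∧ (S (q ++ y) ∧ adj x y))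
  split : ∀ q y → ind (S (q ++ y) ∧ adj (p ++ x) (q ++ y)) ≡ inFibre q y + inColumn q y
  split q y rewrite hdist-++ p q x y = ind-∧-+≡ᵇ1 (S (q ++ y)) (hdist p q) (hdist x y)

ind-∧-mono : ∀ {b c} d → (b ≡ true → c ≡ true) → ind (b ∧ d) ≤ ind (c ∧ d)
ind-∧-mono {false} d b⇒c = z≤n
ind-∧-mono {true}  d b⇒c rewrite b⇒c refl = ≤-refl

degIn-mono : ∀ {m} {S S′ : Subset3 m} → (∀ v → S v ≡ true → S′ v ≡ true) → ∀ v → degIn S v ≤ degIn S′ v
degIn-mono {m} S⊆S′ v = countB-mono (λ w → ind-∧-mono (adj v w) (S⊆S′ w)) (allPts m)

MaxDeg≤1-pullback : ∀ j {j′ k} (S : Subset3 (j + k)) (S′ : Subset3 (j′ + k)) (φ : Pt j → Pt j′) →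
  (∀ p x → S (p ++ x) ≡ true → S′ (φ p ++ x) ≡ true) →
  (∀ p x → S (p ++ x) ≡ true → degIn (λ q → S (q ++ x)) p ≤ degIn (λ q → S′ (q ++ x)) (φ p)) →
  MaxDeg≤1 S′ → MaxDeg≤1 S
MaxDeg≤1-pullback j {j′} S S′ φ S⇒S′ fibre≤ Δ′ z z∈S with splitAt j z
... | p , x , refl = begin
  degIn S (p ++ x)                                                   ≡⟨ degIn-++ j S p x ⟩
  degIn (λ q → S (q ++ x)) p + degIn (λ y → S (p ++ y)) x            ≤⟨ +-mono-≤ (fibre≤ p x z∈S) (degIn-mono (S⇒S′ p) x) ⟩
  degIn (λ q → S′ (q ++ x)) (φ p) + degIn (λ y → S′ (φ p ++ y)) x    ≡⟨ degIn-++ j′ S′ (φ p) x ⟨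
  degIn S′ (φ p ++ x)                                                ≤⟨ Δ′ (φ p ++ x) (S⇒S′ p x z∈S) ⟩
  1                                                                  ∎
  where open ≤-Reasoning

card-++ : ∀ j {k} (S : Subset3 (j + k)) → card S ≡ ∑[ x ∈ allPts k ] card (λ p → S (p ++ x))
card-++ j {k} S = begin
  card S                                                ≡⟨ countB≡∑ S (allPts (j + k)) ⟩
  ∑[ z ∈ allPts (j + k) ] ind (S z)                     ≡⟨ ∑-allPts-++ j _ ⟩
  ∑[ x ∈ allPts k ] ∑[ p ∈ allPts j ] ind (S (p ++ x))  ≡⟨ ∑-cong (allPts k) (λ x → countB≡∑ _ (allPts j)) ⟨
  ∑[ x ∈ allPts k ] card (λ p → S (p ++ x))             ∎
  where open ≡-Reasoning

allLabels : List Label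
allLabels = A ∷ B ∷ C ∷ X ∷ Y ∷ Z ∷ []

∈-allLabels : (l : Label) → l ∈ allLabels
∈-allLabels A = here refl
∈-allLabels B = there (here refl)
∈-allLabels C = there (there (here refl))
∈-allLabels X = there (there (there (here refl)))
∈-allLabels Y = there (there (there (there (here refl))))
∈-allLabels Z = there (there (there (there (there (here refl)))))

byExhaustion : ∀ {m} {P : Label → Pt m → Set} (P? : ∀ l p → Dec (P l p)) →
  {True (all? (λ l → all? (P? l) (allPts m)) allLabels)} → ∀ l p → P l p
byExhaustion P? {holds} l p = lookupAll (lookupAll (toWitness holds) (∈-allLabels l)) (∈-allPts p)

labelSet : Label → Subset3 1
labelSet l (t ∷ []) = ⟦ l ⟧ t

-- (u, w) ↦ w − u, as 2u ≡ −u (mod 3).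
difference : Pt 2 → Pt 1
difference (u ∷ w ∷ []) = (toℕ w + 2 * toℕ u) mod 3 ∷ []

-- For |l| = 1, the preimage of l under the difference: a transversal of H(2, 3), hence independent.
-- For l = Z₃ ∖ {c}, the set {0} × l ∪ (Z₃ ∖ {0}) × {c}: two disjoint edges.
lift : Label → Subset3 2
lift A p = labelSet A (difference p)
lift B p = labelSet B (difference p)
lift C p = labelSet C (difference p)
lift l (u ∷ w ∷ []) = if ⌊ u ≟ zero ⌋ then ⟦ l ⟧ w else not (⟦ l ⟧ w)

lift⊆difference⁻¹ : ∀ l p → lift l p ≡ true → labelSet l (difference p) ≡ true
lift⊆difference⁻¹ = byExhaustion (λ l p → (lift l p ≟ᵇ true) →-dec (labelSet l (difference p) ≟ᵇ true))

degIn-lift≤ : ∀ l p → lift l p ≡ true → degIn (lift l) p ≤ degIn (labelSet l) (difference p)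
degIn-lift≤ = byExhaustion (λ l p → (lift l p ≟ᵇ true) →-dec (degIn (lift l) p ≤? degIn (labelSet l) (difference p)))

card-lift : ∀ l → card (lift l) ≡ card (labelSet l) + 2
card-lift A = refl
card-lift B = refl
card-lift C = refl
card-lift X = refl
card-lift Y = refl
card-lift Z = refl

VofF : ∀ {k} → (Pt k → Label) → Subset3 (suc (suc k))
VofF Uf (u ∷ w ∷ x) = lift (Uf x) (u ∷ w ∷ [])

card-VofF : ∀ {k} (Uf : Pt k → Label) → card (VofF Uf) ≡ card (UofF Uf) + 2 * 3 ^ k
card-VofF {k} Uf = begin
  card (VofF Uf)                                                    ≡⟨ card-++ 2 (VofF Uf) ⟩
  ∑[ x ∈ allPts k ] card (lift (Uf x))                              ≡⟨ ∑-cong (allPts k) (λ x → card-lift (Uf x)) ⟩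
  ∑[ x ∈ allPts k ] (card (labelSet (Uf x)) + 2)                    ≡⟨ ∑-+ (allPts k) ⟩
  ∑[ x ∈ allPts k ] card (labelSet (Uf x)) + ∑[ _ ∈ allPts k ] 2    ≡⟨ cong₂ _+_ (sym (card-++ 1 (UofF Uf))) (∑-allPts-const k 2) ⟩
  card (UofF Uf) + 2 * 3 ^ k                                        ∎
  where open ≡-Reasoning

MaxDeg≤1-VofF : ∀ {k} (Uf : Pt k → Label) → MaxDeg≤1 (UofF Uf) → MaxDeg≤1 (VofF Uf)
MaxDeg≤1-VofF Uf = MaxDeg≤1-pullback 2 (VofF Uf) (UofF Uf) difference
  (λ { (u ∷ w ∷ []) x → lift⊆difference⁻¹ (Uf x) (u ∷ w ∷ []) })
  (λ { (u ∷ w ∷ []) x → degIn-lift≤ (Uf x) (u ∷ w ∷ []) })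

+[m+2n]-+[3n]≡+m-+n : ∀ m n → (+ (m + 2 * n)) - (+ (3 * n)) ≡ (+ m) - (+ n)
+[m+2n]-+[3n]≡+m-+n m n =
  trans (cong₂ _-_ (trans (pos-+ m (2 * n)) (cong (ℤ._+_ (+ m)) (pos-* 2 n))) (pos-* 3 n)) (identity (+ m) (+ n))
  where
  identity : ∀ a b → a ℤ.+ + 2 ℤ.* b - + 3 ℤ.* b ≡ a - b
  identity = ℤ-Solver.solve-∀

lemma4p2 : (k : ℕ) (Uf : Pt k → Label) →
    MaxDeg≤1 (UofF Uf) →
    Σ (Subset3 (suc (suc k))) (λ V →
      ((+ card V) - (+ (3 ^ suc k)) ≡ (+ card (UofF Uf)) - (+ (3 ^ k)))
      × MaxDeg≤1 V)
lemma4p2 k Uf Δ = VofF Uf , cardinality , MaxDeg≤1-VofF Uf Δ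
  where
  cardinality : (+ card (VofF Uf)) - (+ (3 ^ suc k)) ≡ (+ card (UofF Uf)) - (+ (3 ^ k))
  cardinality = trans (cong (λ c → (+ c) - (+ (3 ^ suc k))) (card-VofF Uf)) (+[m+2n]-+[3n]≡+m-+n (card (UofF Uf)) (3 ^ k))
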